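{- Let $G$ and $H$ be finite graphs satisfying at least one of the following conditions: (1) $a(G)\ge\frac12$, and every $S\subsetneq V(H)$ satisfies $|N(S)|>|S|$; (2) $a(G)>\frac12$, and every $S\subseteq V(H)$ satisfies $|N(S)|\ge |S|$. Then every maximum independent set $I\subseteq V(G\times H)$ contains a full copy of $H$, i.e., there is a vertex $v\in V(G)$ such that $\{(v,w): w\in V(H)\}\subseteq I$.
   Context: Tensor product $G\times H$: vertex set $V(G)\times V(H)$, $(u,v)\sim(u',v')$ iff $uu'\in E(G)$ and $vv'\in E(H)$. For a vertex set $S$, $N(S)$ is the set of vertices having a neighbor in $S$. $a(G)=\max_I \frac{|I|}{|I|+|N(I)|}$ over nonempty independent sets $I$ of $G$. -}

module Defs where

open import Data.Nat using (ℕ; _*_; _+_; _≤_; _<_)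
open import Data.Bool using (Bool; true; false; _∧_; if_then_else_)
open import Data.Fin using (Fin; quotient; remainder; combine)
open import Data.Fin.Subset using (Subset; _∈_; ∣_∣; inside; outside; _⊂_; Nonempty)
open import Data.Vec using (tabulate)
open import Data.Product using (Σ; ∃; _×_; _,_)
open import Relation.Binary.PropositionalEquality using (_≡_)
open import Relation.Nullary using (¬_)
open import Relation.Nullary.Decidable using (Dec; yes; no; _×-dec_)
open import Data.Fin.Properties using (any?)
open import Data.Fin.Subset.Properties using (_∈?_)

record Graph : Set where
  field
    n      : ℕ
    adj    : Fin n → Fin n → Bool
    sym    : ∀ u v → adj u v ≡ adj v u
    irrefl : ∀ v → adj v v ≡ false
open Graph public

-- Tensor product G × H on vertex set Fin (n G * n H);
-- the pair (u , v) is encoded as combine u v (decoded by quotient / remainder).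
_⊗_ : Graph → Graph → Graph
G ⊗ H = record
  { n      = n G * n H
  ; adj    = λ x y → adj G (quotient (n H) x) (quotient (n H) y)
                   ∧ adj H (remainder {n G} (n H) x) (remainder {n G} (n H) y)
  ; sym    = λ x y → symProof x y
  ; irrefl = λ x → irreflProof x
  }
  where
  open import Relation.Binary.PropositionalEquality using (cong₂; cong; refl)
  open import Data.Bool.Properties using (∧-zeroˡ)
  qx rx : Fin (n G * n H) → _
  qx x = quotient (n H) x
  rx x = remainder {n G} (n H) x
  symProof : ∀ x y → (adj G (qx x) (qx y) ∧ adj H (rx x) (rx y))
                   ≡ (adj G (qx y) (qx x) ∧ adj H (rx y) (rx x))
  symProof x y = cong₂ _∧_ (sym G _ _) (sym H _ _)
  irreflProof : ∀ x → (adj G (qx x) (qx x) ∧ adj H (rx x) (rx x)) ≡ false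
  irreflProof x rewrite irrefl G (qx x) = refl

N : (G : Graph) → Subset (n G) → Subset (n G)
N G S = tabulate λ v → isN v
  where
  isN : Fin (n G) → _
  isN v with any? (λ u → (u ∈? S) ×-dec (adj G u v Data.Bool.≟ true))
  ... | yes _ = inside
  ... | no  _ = outside

Independent : (G : Graph) → Subset (n G) → Set
Independent G I = ∀ u v → u ∈ I → v ∈ I → adj G u v ≡ false

MaximumIndependent : (G : Graph) → Subset (n G) → Set
MaximumIndependent G I =
  Independent G I × (∀ J → Independent G J → ∣ J ∣ ≤ ∣ I ∣)

-- a(G) ≥ 1/2 : the maximum over nonempty independent I of |I|/(|I|+|N(I)|)
-- is ≥ 1/2, i.e. some nonempty independent I has |I|/(|I|+|N(I)|) ≥ 1/2;
-- the fraction comparison is written by cross-multiplication.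
aAtLeastHalf : Graph → Set
aAtLeastHalf G = Σ (Subset (n G)) λ I →
  Nonempty I × Independent G I × (∣ I ∣ + ∣ N G I ∣ ≤ 2 * ∣ I ∣)

aMoreThanHalf : Graph → Set
aMoreThanHalf G = Σ (Subset (n G)) λ I →
  Nonempty I × Independent G I × (∣ I ∣ + ∣ N G I ∣ < 2 * ∣ I ∣)

Cond1 : Graph → Graph → Set
Cond1 G H = aAtLeastHalf G ×
  (∀ (S : Subset (n H)) → Nonempty S → S ⊂ Data.Fin.Subset.⊤ → ∣ S ∣ < ∣ N H S ∣)

Cond2 : Graph → Graph → Set
Cond2 G H = aMoreThanHalf G × (∀ (S : Subset (n H)) → ∣ S ∣ ≤ ∣ N H S ∣)

ContainsCopy : (G H : Graph) → Subset (n (G ⊗ H)) → Fin (n G) → Set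
ContainsCopy G H I v = ∀ (w : Fin (n H)) → combine v w ∈ I

-- Suppose a maximum independent set I of G × H contains no full copy of H, so that every
-- column x(v) = |I ∩ ({v} × V(H))| has size below |V(H)|.  Filling the columns over an
-- independent J ⊆ V(G) and emptying those over N(J) keeps I independent, hence maximality
-- gives |V(H)|·|J| ≤ Σ_J x + Σ_N(J) x.  On the other hand, for adjacent u, v the column
-- over v avoids the H-neighbourhood of the column over u, so the hypothesis on H bounds
-- x(u) + x(v).  Shrink the independent set witnessing a(G) ≥ 1/2 (resp. > 1/2) to a subset
-- J of maximum surplus |J| - |N(J)|; a fractional Hall argument on J, peeling the weights
-- layer by layer, turns the edge bounds into Σ_J x + Σ_N(J) x < |V(H)|·|J|.

module Submission where

open import Defs hiding (sym)
open import Data.Bool using (Bool; true; false; _∧_; if_then_else_)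
open import Data.Fin using (Fin; zero; suc; _↑ˡ_; _↑ʳ_; combine; quotient; remainder)
open import Data.Fin.Properties using (any?; all?; ¬∀⟶∃¬; remQuot-combine)
open import Data.Fin.Subset
  using (Subset; inside; outside; _∈_; _∉_; _⊆_; _⊂_; _∩_; _∪_; ∣_∣; ⊤; ⊥; Nonempty; Empty)
open import Data.Fin.Subset.Properties
  using ( _∈?_; _⊆?_; anySubset?; nonempty?; Empty-unique; drop-∷-Empty; ∉⊥; ⊆⊤; ∈⊤
        ; ∣p∣≤n; ∣p∣≤∣x∷p∣; ∣⊥∣≡0; ∣⊤∣≡n; p⊆q⇒∣p∣≤∣q∣; p⊂q⇒∣p∣<∣q∣; p∩q⊆p; x∈p∩q⁻; x∈p∪q⁻)
open import Data.Nat
  using (ℕ; zero; suc; pred; _+_; _*_; _⊓_; _≤_; _<_; z≤n; s≤s; s≤s⁻¹; _<?_)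
open import Data.Nat.Induction using (<-wellFounded)
open import Data.Nat.Properties
open import Algebra.Properties.CommutativeMonoid.Sum +-0-commutativeMonoid
  using (sum-syntax; sum-cong-≗; ∑-distrib-+)
open import Algebra.Properties.CommutativeSemigroup +-commutativeSemigroup using (interchange)
open import Data.Product using (∃; _×_; _,_)
open import Data.Sum using (_⊎_; inj₁; inj₂; [_,_]′)
open import Data.Vec using ([]; _∷_; here; there; lookup; tabulate)
open import Data.Vec.Properties
  using (lookup∘tabulate; tabulate∘lookup; tabulate-cong; []=⇒lookup; lookup⇒[]=)
open import Function using (_∘_)
open import Induction.WellFounded using (Acc; acc)
open import Relation.Binary.PropositionalEquality
  using (_≡_; refl; sym; trans; cong; cong₂; subst; subst₂; module ≡-Reasoning)
open import Relation.Nullary using (¬_; Dec; yes; no; does; contradiction)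
open import Relation.Nullary.Decidable using (_×-dec_)

private variable
  m k : ℕ

∈-tabulate⁻ : ∀ {p : Fin m → Bool} {v} → v ∈ tabulate p → p v ≡ true
∈-tabulate⁻ {p = p} {v} v∈ = trans (sym (lookup∘tabulate p v)) ([]=⇒lookup v∈)

x∈p⇒0<∣p∣ : ∀ {p : Subset m} {x} → x ∈ p → 0 < ∣ p ∣
x∈p⇒0<∣p∣ here = s≤s z≤n
x∈p⇒0<∣p∣ {p = s ∷ p} (there x∈p) = ≤-trans (x∈p⇒0<∣p∣ x∈p) (∣p∣≤∣x∷p∣ s p)

0<∣p∣⇒Nonempty : ∀ {p : Subset m} → 0 < ∣ p ∣ → Nonempty p
0<∣p∣⇒Nonempty {m} {p} 0<∣p∣ with nonempty? p
... | yes ne = ne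
... | no ¬ne = contradiction (trans (cong ∣_∣ (Empty-unique ¬ne)) (∣⊥∣≡0 m)) (>⇒≢ 0<∣p∣)

∣p∪q∣≡∣p∣+∣q∣ : ∀ (p q : Subset m) → Empty (p ∩ q) → ∣ p ∪ q ∣ ≡ ∣ p ∣ + ∣ q ∣
∣p∪q∣≡∣p∣+∣q∣ []            []            _    = refl
∣p∪q∣≡∣p∣+∣q∣ (inside  ∷ p) (inside  ∷ q) disj = contradiction (zero , here) disj
∣p∪q∣≡∣p∣+∣q∣ (inside  ∷ p) (outside ∷ q) disj = cong suc (∣p∪q∣≡∣p∣+∣q∣ p q (drop-∷-Empty disj))
∣p∪q∣≡∣p∣+∣q∣ (outside ∷ p) (inside  ∷ q) disj =
  trans (cong suc (∣p∪q∣≡∣p∣+∣q∣ p q (drop-∷-Empty disj))) (sym (+-suc ∣ p ∣ ∣ q ∣))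
∣p∪q∣≡∣p∣+∣q∣ (outside ∷ p) (outside ∷ q) disj = ∣p∪q∣≡∣p∣+∣q∣ p q (drop-∷-Empty disj)

∣p∣+∣q∣≤∣r∣ : ∀ {p q r : Subset m} → Empty (p ∩ q) → p ⊆ r → q ⊆ r → ∣ p ∣ + ∣ q ∣ ≤ ∣ r ∣
∣p∣+∣q∣≤∣r∣ {p = p} {q} disj p⊆r q⊆r =
  subst (_≤ _) (∣p∪q∣≡∣p∣+∣q∣ p q disj) (p⊆q⇒∣p∣≤∣q∣ (λ x∈ → [ p⊆r , q⊆r ]′ (x∈p∪q⁻ p q x∈)))

restrict : (S : Subset m) {P : Fin m → Set} → (∀ v → Dec (P v)) → Subset m
restrict S P? = S ∩ tabulate (λ v → does (P? v))

∈-restrict⁻ : ∀ (S : Subset m) {P : Fin m → Set} (P? : ∀ v → Dec (P v)) {v} →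
              v ∈ restrict S P? → v ∈ S × P v
∈-restrict⁻ S P? {v} v∈ with x∈p∩q⁻ S _ v∈
... | v∈S , v∈P with P? v | ∈-tabulate⁻ v∈P
...   | yes pv | _ = v∈S , pv
...   | no _   | ()

restrict-⊆ : ∀ (S : Subset m) {P : Fin m → Set} (P? : ∀ v → Dec (P v)) → restrict S P? ⊆ S
restrict-⊆ S P? = p∩q⊆p S _

∑-mono-≤ : ∀ {f g : Fin m → ℕ} → (∀ i → f i ≤ g i) → ∑[ i < m ] f i ≤ ∑[ i < m ] g i
∑-mono-≤ {zero}  _   = z≤n
∑-mono-≤ {suc m} f≤g = +-mono-≤ (f≤g zero) (∑-mono-≤ (f≤g ∘ suc))

∑-↑ : ∀ a b (f : Fin (a + b) → ℕ) →
      ∑[ i < a + b ] f i ≡ ∑[ i < a ] f (i ↑ˡ b) + ∑[ j < b ] f (a ↑ʳ j)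
∑-↑ zero    b f = refl
∑-↑ (suc a) b f = trans (cong (f zero +_) (∑-↑ a b (f ∘ suc))) (sym (+-assoc (f zero) _ _))

∑-combine : ∀ m k (f : Fin (m * k) → ℕ) →
            ∑[ p < m * k ] f p ≡ ∑[ v < m ] ∑[ w < k ] f (combine v w)
∑-combine zero    k f = refl
∑-combine (suc m) k f =
  trans (∑-↑ k (m * k) f) (cong (∑[ w < k ] f (w ↑ˡ m * k) +_) (∑-combine m k (f ∘ (k ↑ʳ_))))

∑∈ : Subset m → (Fin m → ℕ) → ℕ
∑∈ {m} S f = ∑[ v < m ] (if lookup S v then f v else 0)

infixl 10 ∑∈
syntax ∑∈ S (λ v → e) = ∑[ v ∈ S ] e

∑∈-mono-≤ : ∀ (S : Subset m) {f g : Fin m → ℕ} →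
            (∀ v → v ∈ S → f v ≤ g v) → ∑[ v ∈ S ] f v ≤ ∑[ v ∈ S ] g v
∑∈-mono-≤ S {f} {g} f≤g = ∑-mono-≤ pointwise
  where
  pointwise : ∀ v → (if lookup S v then f v else 0) ≤ (if lookup S v then g v else 0)
  pointwise v with lookup S v in v∈S
  ... | true  = f≤g v (lookup⇒[]= v S v∈S)
  ... | false = z≤n

∑∈-distrib-+ : ∀ (S : Subset m) (f g : Fin m → ℕ) →
               ∑[ v ∈ S ] (f v + g v) ≡ ∑[ v ∈ S ] f v + ∑[ v ∈ S ] g v
∑∈-distrib-+ S f g =
  trans (sum-cong-≗ pointwise) (∑-distrib-+ (λ v → if lookup S v then f v else 0) _)
  where
  pointwise : ∀ v → (if lookup S v then f v + g v else 0)
                  ≡ (if lookup S v then f v else 0) + (if lookup S v then g v else 0)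
  pointwise v with lookup S v
  ... | true  = refl
  ... | false = refl

∑∈-const : ∀ (S : Subset m) k → ∑[ v ∈ S ] k ≡ ∣ S ∣ * k
∑∈-const []            k = refl
∑∈-const (inside  ∷ S) k = cong (k +_) (∑∈-const S k)
∑∈-const (outside ∷ S) k = ∑∈-const S k

∣p∣≡∑∈1 : ∀ (S : Subset m) → ∣ S ∣ ≡ ∑[ v ∈ S ] 1
∣p∣≡∑∈1 S = sym (trans (∑∈-const S 1) (*-identityʳ ∣ S ∣))

[_] : ∀ {P : Set} → Dec P → ℕ
[ P? ] = if does P? then 1 else 0

∣restrict∣≡∑∈[_] : ∀ (S : Subset m) {P : Fin m → Set} (P? : ∀ v → Dec (P v)) →
                   ∣ restrict S P? ∣ ≡ ∑[ v ∈ S ] [ P? v ]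
∣restrict∣≡∑∈[_] []            P? = refl
∣restrict∣≡∑∈[_] (outside ∷ S) P? = ∣restrict∣≡∑∈[_] S (P? ∘ suc)
∣restrict∣≡∑∈[_] (inside  ∷ S) P? with does (P? zero)
... | true  = cong suc (∣restrict∣≡∑∈[_] S (P? ∘ suc))
... | false = ∣restrict∣≡∑∈[_] S (P? ∘ suc)

m≤pred[m]+[0<m] : ∀ a → a ≤ pred a + [ 0 <? a ]
m≤pred[m]+[0<m] zero    = z≤n
m≤pred[m]+[0<m] (suc a) = ≤-reflexive (+-comm 1 a)

m≤m⊓n+[n<m] : ∀ {a c} → a ≤ suc c → a ≤ a ⊓ c + [ c <? a ]
m≤m⊓n+[n<m] {a} {c} a≤1+c = by-cases (c <? a)
  where
  by-cases : (c<a? : Dec (c < a)) → a ≤ a ⊓ c + [ c<a? ]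
  by-cases (yes c<a) = begin
    a         ≤⟨ a≤1+c ⟩
    suc c     ≡⟨ +-comm 1 c ⟩
    c + 1     ≡⟨ cong (_+ 1) (m≥n⇒m⊓n≡n (<⇒≤ c<a)) ⟨
    a ⊓ c + 1 ∎
    where open ≤-Reasoning
  by-cases (no c≮a) = ≤-reflexive (trans (sym (m≤n⇒m⊓n≡m (≮⇒≥ c≮a))) (sym (+-identityʳ _)))

m≤pred[m]+1 : ∀ a → a ≤ pred a + 1
m≤pred[m]+1 zero    = z≤n
m≤pred[m]+1 (suc a) = ≤-reflexive (+-comm 1 a)

+-pred-≤-pred : ∀ {a h} b → a < h → a + b ≤ h → a + pred b ≤ pred h
+-pred-≤-pred {a} {h} zero    a<h _       = subst (_≤ pred h) (sym (+-identityʳ a)) (<⇒≤pred a<h)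
+-pred-≤-pred {a} {h} (suc b) _   a+b+1≤h = <⇒≤pred (subst (_≤ h) (+-suc a b) a+b+1≤h)

<⇒suc[pred[n]]≡n : ∀ {a h} → a < h → suc (pred h) ≡ h
<⇒suc[pred[n]]≡n (s≤s _) = refl

pred-+-⊓-≤ : ∀ a b c → a + b ≤ suc c → pred a + b ⊓ c ≤ c
pred-+-⊓-≤ zero    b c _       = m⊓n≤n b c
pred-+-⊓-≤ (suc a) b c a+b≤1+c = ≤-trans (+-monoʳ-≤ a (m⊓n≤m b c)) (s≤s⁻¹ a+b≤1+c)

∈N⁻ : ∀ G {S : Subset (n G)} {v} → v ∈ N G S → ∃ λ u → u ∈ S × adj G u v ≡ true
∈N⁻ G {S} {v} v∈N with ∈-tabulate⁻ {v = v} v∈N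
... | isN with any? (λ u → (u ∈? S) ×-dec (adj G u v Data.Bool.≟ true))
...   | yes (u , u∈S , uv) = u , u∈S , uv
...   | no _ with () ← isN

∈N⁺ : ∀ G {S : Subset (n G)} {u v} → u ∈ S → adj G u v ≡ true → v ∈ N G S
∈N⁺ G {S} {u} {v} u∈S uv with lookup (N G S) v in v∈N
... | true  = lookup⇒[]= v _ v∈N
... | false with trans (sym (lookup∘tabulate _ v)) v∈N
...   | isN with any? (λ u → (u ∈? S) ×-dec (adj G u v Data.Bool.≟ true))
...     | yes _ with () ← isN
...     | no ¬∃ = contradiction (u , u∈S , uv) ¬∃

Independent-⊆ : ∀ G {S J : Subset (n G)} → S ⊆ J → Independent G J → Independent G S
Independent-⊆ G S⊆J indJ u v u∈S v∈S = indJ u v (S⊆J u∈S) (S⊆J v∈S)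

-- J maximises the surplus ∣ S ∣ - ∣ N G S ∣ over its subsets S, written without subtraction.
SurplusMaximal : (G : Graph) → Subset (n G) → Set
SurplusMaximal G J = ∀ S → S ⊆ J → ∣ S ∣ + ∣ N G J ∣ ≤ ∣ J ∣ + ∣ N G S ∣

surplus-maximal-subset :
  ∀ G (P : Subset (n G) → Set) →
  (∀ {J S} → S ⊆ J → ∣ J ∣ + ∣ N G S ∣ < ∣ S ∣ + ∣ N G J ∣ → P J → P S) →
  ∀ {J} → P J → ∃ λ K → P K × SurplusMaximal G K
surplus-maximal-subset G P preserved {J} = descend J (<-wellFounded ∣ N G J ∣)
  where
  descend : ∀ J → Acc _<_ ∣ N G J ∣ → P J → ∃ λ K → P K × SurplusMaximal G K
  descend J (acc smaller) pJ
    with anySubset? (λ S → (S ⊆? J) ×-dec (∣ J ∣ + ∣ N G S ∣ <? ∣ S ∣ + ∣ N G J ∣))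
  ... | no ¬larger = J , pJ , λ S S⊆J → ≮⇒≥ (λ larger → ¬larger (S , S⊆J , larger))
  ... | yes (S , S⊆J , larger) = descend S (smaller ∣N∣-decreases) (preserved S⊆J larger pJ)
    where
    ∣N∣-decreases : ∣ N G S ∣ < ∣ N G J ∣
    ∣N∣-decreases = +-cancelˡ-< ∣ J ∣ _ _ (<-≤-trans larger (+-monoˡ-≤ _ (p⊆q⇒∣p∣≤∣q∣ S⊆J)))

-- Y and N(J₀) are disjoint subsets of N(J), as an edge from J₀ to Y would carry weight
-- above 1 + c; surplus maximality of J then bounds ∣ J₀ ∣ + ∣ Y ∣.
top-layer-≤ : ∀ {G J} → SurplusMaximal G J → ∀ c (x y : Fin (n G) → ℕ) →
  (∀ {u v} → u ∈ J → adj G u v ≡ true → x u + y v ≤ suc c) →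
  ∣ restrict J (λ u → 0 <? x u) ∣ + ∣ restrict (N G J) (λ v → c <? y v) ∣ ≤ ∣ J ∣
top-layer-≤ {G} {J} maxJ c x y edge = +-cancelʳ-≤ ∣ N G J₀ ∣ _ _ (begin
  ∣ J₀ ∣ + ∣ Y ∣ + ∣ N G J₀ ∣   ≡⟨ +-assoc ∣ J₀ ∣ _ _ ⟩
  ∣ J₀ ∣ + (∣ Y ∣ + ∣ N G J₀ ∣) ≤⟨ +-monoʳ-≤ ∣ J₀ ∣ (∣p∣+∣q∣≤∣r∣ disjoint Y⊆NJ NJ₀⊆NJ) ⟩
  ∣ J₀ ∣ + ∣ N G J ∣            ≤⟨ maxJ J₀ J₀⊆J ⟩
  ∣ J ∣ + ∣ N G J₀ ∣            ∎)
  where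
  open ≤-Reasoning
  positive : ∀ u → Dec (0 < x u)
  positive u = 0 <? x u
  saturated : ∀ v → Dec (c < y v)
  saturated v = c <? y v

  J₀ = restrict J positive
  Y  = restrict (N G J) saturated

  J₀⊆J : J₀ ⊆ J
  J₀⊆J = restrict-⊆ J positive

  Y⊆NJ : Y ⊆ N G J
  Y⊆NJ = restrict-⊆ (N G J) saturated

  NJ₀⊆NJ : N G J₀ ⊆ N G J
  NJ₀⊆NJ v∈ with ∈N⁻ G v∈
  ... | u , u∈J₀ , uv = ∈N⁺ G (J₀⊆J u∈J₀) uv

  disjoint : Empty (Y ∩ N G J₀)
  disjoint (v , v∈) with x∈p∩q⁻ Y (N G J₀) v∈
  ... | v∈Y , v∈NJ₀ with ∈N⁻ G v∈NJ₀ | ∈-restrict⁻ (N G J) saturated v∈Y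
  ... | u , u∈J₀ , uv | _ , c<yv with ∈-restrict⁻ J positive u∈J₀
  ... | u∈J , 0<xu = <⇒≱ (+-mono-≤ 0<xu c<yv) (edge u∈J uv)

-- A fractional Hall inequality for J of maximum surplus, proved by peeling off the top
-- layer of the weights and recursing on the budget c.
weighted-surplus-bound : ∀ {G J} → SurplusMaximal G J → ∀ c (x y : Fin (n G) → ℕ) →
  (∀ u → u ∈ J → x u ≤ c) → (∀ v → v ∈ N G J → y v ≤ c) →
  (∀ {u v} → u ∈ J → adj G u v ≡ true → x u + y v ≤ c) →
  ∑[ u ∈ J ] x u + ∑[ v ∈ N G J ] y v ≤ c * ∣ J ∣
weighted-surplus-bound {G} {J} _ zero x y x≤0 y≤0 _ = begin
  ∑[ u ∈ J ] x u + ∑[ v ∈ N G J ] y v ≤⟨ +-mono-≤ (∑∈-mono-≤ J x≤0) (∑∈-mono-≤ (N G J) y≤0) ⟩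
  ∑[ u ∈ J ] 0 + ∑[ v ∈ N G J ] 0     ≡⟨ cong₂ _+_ (∑∈-const J 0) (∑∈-const (N G J) 0) ⟩
  ∣ J ∣ * 0 + ∣ N G J ∣ * 0           ≡⟨ cong₂ _+_ (*-zeroʳ ∣ J ∣) (*-zeroʳ ∣ N G J ∣) ⟩
  0                                   ∎
  where open ≤-Reasoning
weighted-surplus-bound {G} {J} maxJ (suc c) x y x≤ y≤ edge = begin
  ∑[ u ∈ J ] x u + ∑[ v ∈ N G J ] y v
    ≤⟨ +-mono-≤ (∑∈-mono-≤ J λ u _ → m≤pred[m]+[0<m] (x u))
                (∑∈-mono-≤ (N G J) λ v v∈ → m≤m⊓n+[n<m] (y≤ v v∈)) ⟩
  ∑[ u ∈ J ] (x′ u + [ 0 <? x u ]) + ∑[ v ∈ N G J ] (y′ v + [ c <? y v ])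
    ≡⟨ cong₂ _+_ (∑∈-distrib-+ J x′ _) (∑∈-distrib-+ (N G J) y′ _) ⟩
  (∑[ u ∈ J ] x′ u + ∑[ u ∈ J ] [ 0 <? x u ]) + (∑[ v ∈ N G J ] y′ v + ∑[ v ∈ N G J ] [ c <? y v ])
    ≡⟨ interchange (∑[ u ∈ J ] x′ u) _ _ _ ⟩
  (∑[ u ∈ J ] x′ u + ∑[ v ∈ N G J ] y′ v) + (∑[ u ∈ J ] [ 0 <? x u ] + ∑[ v ∈ N G J ] [ c <? y v ])
    ≡⟨ cong (∑[ u ∈ J ] x′ u + ∑[ v ∈ N G J ] y′ v +_)
            (cong₂ _+_ (∣restrict∣≡∑∈[_] J (λ u → 0 <? x u))
                       (∣restrict∣≡∑∈[_] (N G J) (λ v → c <? y v))) ⟨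
  (∑[ u ∈ J ] x′ u + ∑[ v ∈ N G J ] y′ v)
    + (∣ restrict J (λ u → 0 <? x u) ∣ + ∣ restrict (N G J) (λ v → c <? y v) ∣)
    ≤⟨ +-mono-≤ lower-layers (top-layer-≤ maxJ c x y edge) ⟩
  c * ∣ J ∣ + ∣ J ∣
    ≡⟨ +-comm (c * ∣ J ∣) ∣ J ∣ ⟩
  suc c * ∣ J ∣ ∎
  where
  open ≤-Reasoning
  x′ y′ : Fin (n G) → ℕ
  x′ u = pred (x u)
  y′ v = y v ⊓ c

  lower-layers : ∑[ u ∈ J ] x′ u + ∑[ v ∈ N G J ] y′ v ≤ c * ∣ J ∣
  lower-layers = weighted-surplus-bound maxJ c x′ y′
    (λ u u∈J → pred-mono-≤ (x≤ u u∈J))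
    (λ v _ → m⊓n≤n (y v) c)
    (λ {u} {v} u∈J uv → pred-+-⊓-≤ (x u) (y v) c (edge u∈J uv))

-- a(G) ≥ 1/2 (d = 0) and a(G) > 1/2 (d = 1) are witnessed by such sets.
Deficient : (G : Graph) → ℕ → Subset (n G) → Set
Deficient G d J = Nonempty J × Independent G J × ∣ N G J ∣ + d ≤ ∣ J ∣

Deficient-larger-surplus : ∀ G d {J S} → S ⊆ J → ∣ J ∣ + ∣ N G S ∣ < ∣ S ∣ + ∣ N G J ∣ →
                           Deficient G d J → Deficient G d S
Deficient-larger-surplus G d {J} {S} S⊆J larger (_ , indJ , NJ+d≤J) =
  0<∣p∣⇒Nonempty (≤-trans (s≤s z≤n) NS+d<S) , Independent-⊆ G S⊆J indJ , <⇒≤ NS+d<S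
  where
  open ≤-Reasoning
  NS+d<S : ∣ N G S ∣ + d < ∣ S ∣
  NS+d<S = +-cancelʳ-< ∣ N G J ∣ _ _ (begin-strict
    ∣ N G S ∣ + d + ∣ N G J ∣   ≡⟨ +-assoc ∣ N G S ∣ d _ ⟩
    ∣ N G S ∣ + (d + ∣ N G J ∣) ≡⟨ cong (∣ N G S ∣ +_) (+-comm d _) ⟩
    ∣ N G S ∣ + (∣ N G J ∣ + d) ≤⟨ +-monoʳ-≤ ∣ N G S ∣ NJ+d≤J ⟩
    ∣ N G S ∣ + ∣ J ∣           ≡⟨ +-comm ∣ N G S ∣ ∣ J ∣ ⟩
    ∣ J ∣ + ∣ N G S ∣           <⟨ larger ⟩
    ∣ S ∣ + ∣ N G J ∣           ∎)

-- The hypothesis is the cross-multiplied ∣ J ∣ / (∣ J ∣ + ∣ N(J) ∣) ≥ 1/2, strict when d = 1.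
half-bound⇒deficiency : ∀ d j k → d + (j + k) ≤ 2 * j → k + d ≤ j
half-bound⇒deficiency d j k bound = +-cancelˡ-≤ j (k + d) j
  (subst₂ _≤_ (trans (+-comm d (j + k)) (+-assoc j k d)) (cong (j +_) (+-identityʳ j)) bound)

Deficient⇒surplus-maximal : ∀ G d {J} → Deficient G d J →
                            ∃ λ K → Deficient G d K × SurplusMaximal G K
Deficient⇒surplus-maximal G d =
  surplus-maximal-subset G (Deficient G d) (Deficient-larger-surplus G d)

module Columns (m k : ℕ) where

  column : Subset (m * k) → Fin m → Subset k
  column S v = tabulate λ w → lookup S (combine v w)

  fromColumns : (Fin m → Subset k) → Subset (m * k)
  fromColumns C = tabulate λ p → lookup (C (quotient k p)) (remainder {m} k p)

  ∈-column⁻ : ∀ {S v w} → w ∈ column S v → combine v w ∈ S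
  ∈-column⁻ {S} w∈ = lookup⇒[]= _ S (∈-tabulate⁻ w∈)

  ∈-fromColumns⁻ : ∀ {C p} → p ∈ fromColumns C → remainder {m} k p ∈ C (quotient k p)
  ∈-fromColumns⁻ {C} p∈ = lookup⇒[]= _ (C _) (∈-tabulate⁻ p∈)

  column-fromColumns : ∀ C v → column (fromColumns C) v ≡ C v
  column-fromColumns C v = trans (tabulate-cong lookup-combine) (tabulate∘lookup (C v))
    where
    lookup-combine : ∀ w → lookup (fromColumns C) (combine v w) ≡ lookup (C v) w
    lookup-combine w = trans (lookup∘tabulate _ (combine v w))
                             (cong (λ (v′ , w′) → lookup (C v′) w′) (remQuot-combine v w))

  ∣p∣≡∑∣column∣ : ∀ S → ∣ S ∣ ≡ ∑[ v < m ] ∣ column S v ∣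
  ∣p∣≡∑∣column∣ S = begin
    ∣ S ∣
      ≡⟨ ∣p∣≡∑∈1 S ⟩
    ∑[ p ∈ S ] 1
      ≡⟨ ∑-combine m k (λ p → if lookup S p then 1 else 0) ⟩
    ∑[ v < m ] ∑[ w < k ] (if lookup S (combine v w) then 1 else 0)
      ≡⟨ sum-cong-≗ ∑column ⟨
    ∑[ v < m ] ∣ column S v ∣
      ∎
    where
    open ≡-Reasoning
    ∑column : ∀ v → ∣ column S v ∣ ≡ ∑[ w < k ] (if lookup S (combine v w) then 1 else 0)
    ∑column v = trans (∣p∣≡∑∈1 (column S v))
      (sum-cong-≗ λ w → cong (if_then 1 else 0) (lookup∘tabulate (lookup S ∘ combine v) w))

  ∣fromColumns∣ : ∀ C → ∣ fromColumns C ∣ ≡ ∑[ v < m ] ∣ C v ∣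
  ∣fromColumns∣ C =
    trans (∣p∣≡∑∣column∣ (fromColumns C)) (sum-cong-≗ (cong ∣_∣ ∘ column-fromColumns C))

module TensorProduct (G H : Graph) where

  open Columns (n G) (n H) public

  ∑∣column∣ : Subset (n (G ⊗ H)) → Subset (n G) → ℕ
  ∑∣column∣ I S = ∑[ v ∈ S ] ∣ column I v ∣

  adj-⊗-combine : ∀ u v w w′ → adj (G ⊗ H) (combine u w) (combine v w′) ≡ adj G u v ∧ adj H w w′
  adj-⊗-combine u v w w′ = cong₂ (λ (u′ , w″) (v′ , w‴) → adj G u′ v′ ∧ adj H w″ w‴)
                                 (remQuot-combine u w) (remQuot-combine v w′)

  columns-independent : ∀ {I u v w w′} → Independent (G ⊗ H) I → adj G u v ≡ true →
                        w ∈ column I u → w′ ∈ column I v → adj H w w′ ≡ false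
  columns-independent {I} {u} {v} {w} {w′} indI uv w∈ w′∈ = begin
    adj H w w′                              ≡⟨ cong (_∧ adj H w w′) uv ⟨
    adj G u v ∧ adj H w w′                  ≡⟨ adj-⊗-combine u v w w′ ⟨
    adj (G ⊗ H) (combine u w) (combine v w′) ≡⟨ indI _ _ (∈-column⁻ w∈) (∈-column⁻ w′∈) ⟩
    false                                   ∎
    where open ≡-Reasoning

  fromColumns-independent :
    ∀ C → (∀ {u v w w′} → adj G u v ≡ true → w ∈ C u → w′ ∈ C v → adj H w w′ ≡ false) →
    Independent (G ⊗ H) (fromColumns C)
  fromColumns-independent C compatible p q p∈ q∈
    with adj G (quotient (n H) p) (quotient (n H) q) in uv
  ... | false = refl
  ... | true  = compatible uv (∈-fromColumns⁻ {C} p∈) (∈-fromColumns⁻ {C} q∈)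

  ∣N[column]∣+∣column∣≤n : ∀ {I u v} → Independent (G ⊗ H) I → adj G u v ≡ true →
                          ∣ N H (column I u) ∣ + ∣ column I v ∣ ≤ n H
  ∣N[column]∣+∣column∣≤n {I} {u} {v} indI uv =
    subst (_≤ n H) (∣p∪q∣≡∣p∣+∣q∣ _ _ disjoint) (∣p∣≤n (N H (column I u) ∪ column I v))
    where
    disjoint : Empty (N H (column I u) ∩ column I v)
    disjoint (w′ , w′∈) with x∈p∩q⁻ (N H (column I u)) _ w′∈
    ... | w′∈N , w′∈Iv with ∈N⁻ H w′∈N
    ... | w , w∈Iu , ww′ =
      contradiction (trans (sym ww′) (columns-independent indI uv w∈Iu w′∈Iv)) λ ()

  -- Fill the columns over J and empty those over N(J): the result is again independent.
  exchange-bound : ∀ {I J} → MaximumIndependent (G ⊗ H) I → Independent G J →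
                   n H * ∣ J ∣ ≤ ∑∣column∣ I J + ∑∣column∣ I (N G J)
  exchange-bound {I} {J} (indI , maximum) indJ = +-cancelˡ-≤ (∑[ v < n G ] x v) _ _ (begin
    ∑[ v < n G ] x v + n H * ∣ J ∣
      ≡⟨ cong (∑[ v < n G ] x v +_) (trans (*-comm (n H) ∣ J ∣) (sym (∑∈-const J (n H)))) ⟩
    ∑[ v < n G ] x v + ∑[ v ∈ J ] n H
      ≡⟨ ∑-distrib-+ x (λ v → if lookup J v then n H else 0) ⟨
    ∑[ v < n G ] (x v + (if lookup J v then n H else 0))
      ≤⟨ ∑-mono-≤ exchanged-column ⟩
    ∑[ v < n G ] (∣ C′ v ∣ + (x-over J v + x-over (N G J) v))
      ≡⟨ trans (∑-distrib-+ (∣_∣ ∘ C′) _)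
               (cong (∑[ v < n G ] ∣ C′ v ∣ +_) (∑-distrib-+ (x-over J) (x-over (N G J)))) ⟩
    ∑[ v < n G ] ∣ C′ v ∣ + (∑[ v ∈ J ] x v + ∑[ v ∈ N G J ] x v)
      ≤⟨ +-monoˡ-≤ _ ∣I′∣≤∣I∣ ⟩
    ∑[ v < n G ] x v + (∑[ v ∈ J ] x v + ∑[ v ∈ N G J ] x v) ∎)
    where
    open ≤-Reasoning
    x : Fin (n G) → ℕ
    x v = ∣ column I v ∣

    x-over : Subset (n G) → Fin (n G) → ℕ
    x-over S v = if lookup S v then x v else 0

    C′ : Fin (n G) → Subset (n H)
    C′ v = if lookup J v then ⊤ else if lookup (N G J) v then ⊥ else column I v

    ∈-C′⁻ : ∀ {v w} → w ∈ C′ v → v ∈ J ⊎ (v ∉ N G J × w ∈ column I v)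
    ∈-C′⁻ {v} w∈ with lookup J v in v∈J | lookup (N G J) v in v∉NJ
    ... | true  | _     = inj₁ (lookup⇒[]= v J v∈J)
    ... | false | true  = contradiction w∈ ∉⊥
    ... | false | false =
      inj₂ ((λ v∈NJ → contradiction (trans (sym v∉NJ) ([]=⇒lookup v∈NJ)) λ ()) , w∈)

    compatible : ∀ {u v w w′} → adj G u v ≡ true → w ∈ C′ u → w′ ∈ C′ v → adj H w w′ ≡ false
    compatible {u} {v} uv w∈ w′∈ with ∈-C′⁻ w∈ | ∈-C′⁻ w′∈
    ... | inj₁ u∈J        | inj₁ v∈J         =
      contradiction (trans (sym uv) (indJ u v u∈J v∈J)) λ ()
    ... | inj₁ u∈J        | inj₂ (v∉NJ , _)  = contradiction (∈N⁺ G u∈J uv) v∉NJ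
    ... | inj₂ (u∉NJ , _) | inj₁ v∈J         =
      contradiction (∈N⁺ G v∈J (trans (Graph.sym G v u) uv)) u∉NJ
    ... | inj₂ (_ , w∈Iu) | inj₂ (_ , w′∈Iv) = columns-independent indI uv w∈Iu w′∈Iv

    exchanged-column : ∀ v → x v + (if lookup J v then n H else 0)
                           ≤ ∣ C′ v ∣ + (x-over J v + x-over (N G J) v)
    exchanged-column v with lookup J v | lookup (N G J) v
    ... | true  | v∈NJ  = begin
      x v + n H                            ≡⟨ +-comm (x v) (n H) ⟩
      n H + x v                            ≤⟨ +-monoʳ-≤ (n H) (m≤m+n (x v) _) ⟩
      n H + (x v + rest)                   ≡⟨ cong (_+ (x v + rest)) (∣⊤∣≡n (n H)) ⟨
      ∣ ⊤ {n H} ∣ + (x v + rest)           ∎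
      where rest = if v∈NJ then x v else 0
    ... | false | true  =
      ≤-reflexive (trans (+-identityʳ (x v)) (cong (_+ x v) (sym (∣⊥∣≡0 (n H)))))
    ... | false | false = ≤-refl

    ∣I′∣≤∣I∣ : ∑[ v < n G ] ∣ C′ v ∣ ≤ ∑[ v < n G ] x v
    ∣I′∣≤∣I∣ = subst₂ _≤_ (∣fromColumns∣ C′) (∣p∣≡∑∣column∣ I)
                         (maximum (fromColumns C′) (fromColumns-independent C′ compatible))

  ∣column∣<n : ∀ {I v} → column I v ⊂ ⊤ → ∣ column I v ∣ < n H
  ∣column∣<n {I} {v} I⊂⊤ = subst (∣ column I v ∣ <_) (∣⊤∣≡n (n H)) (p⊂q⇒∣p∣<∣q∣ I⊂⊤)

  column-⊂-⊤ : ∀ {I v} → ¬ (∀ w → combine v w ∈ I) → column I v ⊂ ⊤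
  column-⊂-⊤ {I} {v} ¬full with ¬∀⟶∃¬ (n H) _ (λ w → combine v w ∈? I) ¬full
  ... | w , w∉I = ⊆⊤ , w , ∈⊤ , w∉I ∘ ∈-column⁻ {I} {v}

  ∑∣column∣-<-expanding :
    ∀ {I J} → Independent (G ⊗ H) I → (∀ v → column I v ⊂ ⊤) →
    (∀ S → Nonempty S → S ⊂ ⊤ → ∣ S ∣ < ∣ N H S ∣) → Nonempty J → SurplusMaximal G J →
    ∑∣column∣ I J + ∑∣column∣ I (N G J) < n H * ∣ J ∣
  ∑∣column∣-<-expanding {I} {J} indI proper expanding (u₀ , u₀∈J) maxJ = begin-strict
    ∑[ v ∈ J ] x v + ∑[ v ∈ N G J ] x v
      ≤⟨ weighted-surplus-bound maxJ c x x (λ u _ → <⇒≤pred (x<n u)) (λ v _ → <⇒≤pred (x<n v))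
                                            (λ _ uv → <⇒≤pred (edge uv)) ⟩
    c * ∣ J ∣      <⟨ m<n+m (c * ∣ J ∣) (x∈p⇒0<∣p∣ u₀∈J) ⟩
    suc c * ∣ J ∣  ≡⟨ cong (_* ∣ J ∣) (<⇒suc[pred[n]]≡n (x<n u₀)) ⟩
    n H * ∣ J ∣    ∎
    where
    open ≤-Reasoning
    x : Fin (n G) → ℕ
    x v = ∣ column I v ∣
    c = pred (n H)
    x<n : ∀ v → x v < n H
    x<n v = ∣column∣<n {I} {v} (proper v)

    edge : ∀ {u v} → adj G u v ≡ true → x u + x v < n H
    edge {u} {v} uv with nonempty? (column I u)
    ... | yes ne = begin-strict
      x u + x v                  <⟨ +-monoˡ-< (x v) (expanding _ ne (proper u)) ⟩
      ∣ N H (column I u) ∣ + x v ≤⟨ ∣N[column]∣+∣column∣≤n indI uv ⟩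
      n H                        ∎
    ... | no ¬ne = subst (λ a → a + x v < n H)
                         (sym (trans (cong ∣_∣ (Empty-unique ¬ne)) (∣⊥∣≡0 (n H)))) (x<n v)

  ∑∣column∣-<-hall :
    ∀ {I J} → Independent (G ⊗ H) I → (∀ v → column I v ⊂ ⊤) →
    (∀ S → ∣ S ∣ ≤ ∣ N H S ∣) → Nonempty J → ∣ N G J ∣ < ∣ J ∣ → SurplusMaximal G J →
    ∑∣column∣ I J + ∑∣column∣ I (N G J) < n H * ∣ J ∣
  ∑∣column∣-<-hall {I} {J} indI proper hall (u₀ , _) NJ<J maxJ = begin-strict
    ∑[ v ∈ J ] x v + ∑[ v ∈ N G J ] x v
      ≤⟨ +-monoʳ-≤ (∑[ v ∈ J ] x v) (∑∈-mono-≤ (N G J) λ v _ → m≤pred[m]+1 (x v)) ⟩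
    ∑[ v ∈ J ] x v + ∑[ v ∈ N G J ] (pred (x v) + 1)
      ≡⟨ cong (∑[ v ∈ J ] x v +_) (∑∈-distrib-+ (N G J) (pred ∘ x) (λ _ → 1)) ⟩
    ∑[ v ∈ J ] x v + (∑[ v ∈ N G J ] pred (x v) + ∑[ v ∈ N G J ] 1)
      ≡⟨ cong (λ k → ∑[ v ∈ J ] x v + (∑[ v ∈ N G J ] pred (x v) + k)) (∣p∣≡∑∈1 (N G J)) ⟨
    ∑[ v ∈ J ] x v + (∑[ v ∈ N G J ] pred (x v) + ∣ N G J ∣)
      ≡⟨ +-assoc (∑[ v ∈ J ] x v) _ _ ⟨
    ∑[ v ∈ J ] x v + ∑[ v ∈ N G J ] pred (x v) + ∣ N G J ∣
      ≤⟨ +-monoˡ-≤ ∣ N G J ∣ (weighted-surplus-bound maxJ c x (pred ∘ x) (λ u _ → x≤c u)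
                                (λ v _ → ≤-trans pred[n]≤n (x≤c v)) edge) ⟩
    c * ∣ J ∣ + ∣ N G J ∣  <⟨ +-monoʳ-< (c * ∣ J ∣) NJ<J ⟩
    c * ∣ J ∣ + ∣ J ∣      ≡⟨ +-comm (c * ∣ J ∣) ∣ J ∣ ⟩
    suc c * ∣ J ∣          ≡⟨ cong (_* ∣ J ∣) (<⇒suc[pred[n]]≡n (x<n u₀)) ⟩
    n H * ∣ J ∣            ∎
    where
    open ≤-Reasoning
    x : Fin (n G) → ℕ
    x v = ∣ column I v ∣
    c = pred (n H)
    x<n : ∀ v → x v < n H
    x<n v = ∣column∣<n {I} {v} (proper v)
    x≤c : ∀ v → x v ≤ c
    x≤c v = <⇒≤pred (x<n v)

    edge : ∀ {u v} → u ∈ J → adj G u v ≡ true → x u + pred (x v) ≤ c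
    edge {u} {v} _ uv = +-pred-≤-pred (x v) (x<n u) (begin
      x u + x v                  ≤⟨ +-monoˡ-≤ (x v) (hall (column I u)) ⟩
      ∣ N H (column I u) ∣ + x v ≤⟨ ∣N[column]∣+∣column∣≤n indI uv ⟩
      n H                        ∎)

  small-∑∣column∣ :
    ∀ {I} → Independent (G ⊗ H) I → (∀ v → column I v ⊂ ⊤) → Cond1 G H ⊎ Cond2 G H →
    ∃ λ J → Independent G J × ∑∣column∣ I J + ∑∣column∣ I (N G J) < n H * ∣ J ∣
  small-∑∣column∣ indI proper (inj₁ ((J₀ , ne , indJ₀ , half) , expanding))
    with Deficient⇒surplus-maximal G 0 (ne , indJ₀ , half-bound⇒deficiency 0 _ _ half)
  ... | J , (neJ , indJ , _) , maxJ =
    J , indJ , ∑∣column∣-<-expanding indI proper expanding neJ maxJ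
  small-∑∣column∣ indI proper (inj₂ ((J₀ , ne , indJ₀ , half) , hall))
    with Deficient⇒surplus-maximal G 1 (ne , indJ₀ , half-bound⇒deficiency 1 _ _ half)
  ... | J , (neJ , indJ , NJ+1≤J) , maxJ =
    J , indJ , ∑∣column∣-<-hall indI proper hall neJ (subst (_≤ ∣ J ∣) (+-comm _ 1) NJ+1≤J) maxJ

lemma3p7 : (G H : Graph) → Cond1 G H ⊎ Cond2 G H →
    (I : Subset (n (G ⊗ H))) → MaximumIndependent (G ⊗ H) I →
    ∃ λ v → ContainsCopy G H I v
lemma3p7 G H cond I maxI@(indI , _) with any? (λ v → all? (λ w → combine v w ∈? I))
... | yes copy = copy
... | no ¬copy =
  let J , indJ , small = small-∑∣column∣ indI (λ v → column-⊂-⊤ (λ full → ¬copy (v , full))) cond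
  in  contradiction (exchange-bound maxI indJ) (<⇒≱ small)
  where open TensorProduct G H
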